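{- For every integer $m\ge1$, the number $n_m$ satisfies $\rho(n_m)\ge\rho(n)$ for all $n\in S_m$; that is, $n_m$ is an LR number.
   Context: For an integer $n\ge 2$, $\sigma(n)$ is the sum of the positive divisors of $n$ and $\rho(n):=\sigma(n)/n$. For $n=\prod_{i} p_i^{a_i}$, let $\omega(n):=\sum_i a_i$ (sum of the exponents in the prime factorization). For $m\ge1$ let $S_m:=\{n\in\mathbb{N}: n\ge 2,\ \omega(n)=m\}$. An element $n\in S_m$ with $\rho(n)\ge\rho(n')$ for all $n'\in S_m$ is called an LR (largest rho-value) number. Consider all pairs $(q,k)$ with $q$ prime and $k\ge 1$ an integer, with value $z_{q,k}:=q+q^2+\cdots+q^k$. Enumerate these pairs as $(q_1,k_1),(q_2,k_2),\dots$ so that $z_i:=z_{q_i,k_i}$ is nondecreasing in $i$; if $z_{q,k}=z_{p,j}$ with $q>p$, then $(q,k)$ comes before $(p,j)$. For $m\ge1$ let $E_m$ be the set of the first $m$ pairs; for each prime $p$ let $k_p$ be the largest $k$ with $(p,k)\in E_m$ ($k_p=0$ if none), and define $n_m:=\prod_p p^{k_p}$. -}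

module Defs where

open import Data.Nat using (ℕ; zero; suc; _+_; _*_; _^_; _≤_; _<_; _⊔_; _≟_; _<?_)
open import Data.Nat.Divisibility using (_∣?_)
open import Data.Nat.Primality using (Prime; prime?)
open import Data.List using (List; []; _∷_; filter; applyUpTo; upTo; length; map; concatMap; foldr)
open import Data.Nat.ListAction using (sum; product)
open import Data.List.Relation.Unary.All using (All)
open import Data.Product using (Σ; _×_; _,_)
open import Data.Integer using (+_)
open import Data.Rational using (ℚ; _/_)
open import Relation.Binary.PropositionalEquality using (_≡_)
open import Relation.Nullary using (Dec; _×-dec_; _⊎-dec_)
open import Data.Sum using (_⊎_)

σ : ℕ → ℕ
σ n = sum (filter (λ d → d ∣? n) (applyUpTo suc n))

-- ρ(n) = σ(n)/n as a rational (ρ 0 := 0, never used since n ≥ 2)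
ρ : ℕ → ℚ
ρ zero    = + 0 / 1
ρ (suc k) = + σ (suc k) / suc k

-- ω(n) = m  (sum of exponents in prime factorisation = number of prime
-- factors counted with multiplicity): n is a product of a list of m primes
HasΩ : ℕ → ℕ → Set
HasΩ n m = Σ (List ℕ) (λ ps → All Prime ps × product ps ≡ n × length ps ≡ m)

InS : ℕ → ℕ → Set
InS m n = 2 ≤ n × HasΩ n m

z : ℕ → ℕ → ℕ
z q k = sum (map (q ^_) (applyUpTo suc k))

Before : ℕ → ℕ → ℕ → ℕ → Set
Before q k p j = z q k < z p j ⊎ (z q k ≡ z p j × p < q)

before? : ∀ q k p j → Dec (Before q k p j)
before? q k p j = (z q k <? z p j) ⊎-dec ((z q k ≟ z p j) ×-dec (p <? q))

pairsUpTo : ℕ → List (ℕ × ℕ)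
pairsUpTo B = concatMap (λ q → map (λ k → (q , k)) (applyUpTo suc B))
                        (filter prime? (upTo (suc B)))

-- rank of (p,j): number of pairs (q,k) (q prime, k ≥ 1) coming before it.
-- Any such pair has q ≤ z q k ≤ z p j and k ≤ z q k ≤ z p j, so the bound
-- B = z p j captures all of them.
rank : ℕ → ℕ → ℕ
rank p j = length (filter (λ qk → before? (Data.Product.proj₁ qk) (Data.Product.proj₂ qk) p j)
                          (pairsUpTo (z p j)))

InE : ℕ → ℕ → ℕ → Set
InE m p k = Prime p × 1 ≤ k × rank p k < m

-- bound: the pairs (2,1),…,(2,m) all have z ≤ 2^(m+1), so every pair in E_m
-- has z ≤ 2^(m+1), hence p ≤ 2^(m+1) and k ≤ 2^(m+1).
bound : ℕ → ℕ
bound m = 2 ^ suc m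

-- k_p: largest k with (p,k) ∈ E_m, 0 if none (for prime p)
kp : ℕ → ℕ → ℕ
kp m p = foldr _⊔_ 0 (filter (λ k → rank p k <? m) (applyUpTo suc (bound m)))

nm : ℕ → ℕ
nm m = product (map (λ p → p ^ kp m p) (filter prime? (upTo (suc (bound m)))))

module Submission where

-- E_m consists of the m pairs (q, k) with the smallest values z q k = q + … + q ^ k, and
-- n_m = ∏ q ^ k_q.  Since σ (q ^ a) = 1 + z q a and σ (q ^ (a + 1)) = 1 + q σ (q ^ a), the
-- quantity σ (q ^ a) t ^ a / (q (t + 1)) ^ a increases with a as long as z q a ≤ t and decreases
-- once z q a ≥ t.  The rank of a pair (the number of pairs before it) is a bijection onto ℕ, so
-- if t is the z-value of the pair of rank m, then z q k ≤ t for 1 ≤ k ≤ k_q and z q k ≥ t for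
-- k > k_q.  Hence for every prime q and any exponent a,
--   σ (q ^ a) t ^ a (q (t + 1)) ^ k_q ≤ σ (q ^ k_q) t ^ k_q (q (t + 1)) ^ a,
-- and multiplying over all primes, for n with exponents a_q and Σ a_q = m = Σ k_q, leaves
-- σ (n) n_m ≤ σ (n_m) n.

open import Algebra.Bundles using (CommutativeSemigroup)
open import Algebra.Structures using (IsCommutativeMonoid)
import Algebra.Properties.CommutativeSemigroup as CommutativeSemigroupProperties
open import Data.Bool using (true; false; if_then_else_)
import Data.Integer as ℤ
import Data.Integer.Properties as ℤ
open import Data.List using (List; []; _∷_; _++_; filter; applyUpTo; upTo; map; foldr; length; concatMap; replicate)
open import Data.List.Membership.Propositional using (_∈_)
open import Data.List.Membership.Propositional.Properties using (∈-filter⁺; ∈-filter⁻; ∈-applyUpTo⁺)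
open import Data.List.Properties using (map-applyUpTo; map-++; map-∘; map-id; length-++; length-replicate)
open import Data.List.Relation.Unary.All using (All; []; _∷_)
import Data.List.Relation.Unary.All as All
import Data.List.Relation.Unary.All.Properties as All
open import Data.List.Relation.Unary.Any using (here; there)
open import Data.Nat
open import Data.Nat.Coprimality using (Coprime; coprime-divisor)
open import Data.Nat.Divisibility
open import Data.Nat.ListAction using (sum; product)
open import Data.Nat.ListAction.Properties using (sum-++; product-++)
open import Data.Nat.Primality
  using (Prime; prime?; prime⇒nonZero; prime⇒nonTrivial; prime[2]; ¬prime[1]; prime⇒irreducible; euclidsLemma;
         productOfPrimes≢0; productOfPrimes≥1)
open import Data.Nat.Properties
open import Data.Nat.Solver using (module +-*-Solver)
open import Data.Product using (∃; ∃₂; _×_; _,_; proj₁; proj₂)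
import Data.Rational
import Data.Rational.Properties as ℚ
import Data.Rational.Unnormalised as ℚᵘ
import Data.Rational.Unnormalised.Properties as ℚᵘ
open import Data.Sum using (_⊎_; inj₁; inj₂)
open import Function using (_∘_; id)
open import Relation.Binary using (tri<; tri≈; tri>)
open import Relation.Binary.PropositionalEquality
open import Relation.Nullary using (Dec; yes; no; does; ¬_; contradiction; _×-dec_)
open import Relation.Nullary.Decidable using (dec-true; dec-false)
open import Relation.Unary using (Pred; Decidable)

open import Defs
open +-*-Solver using (solve; _:+_; _:*_; _:=_; con)

if-yes : ∀ {a p} {A : Set a} {P : Set p} (P? : Dec P) {x y : A} → P → (if does P? then x else y) ≡ x
if-yes P? {x} {y} p = cong (if_then x else y) (dec-true P? p)

if-no : ∀ {a p} {A : Set a} {P : Set p} (P? : Dec P) {x y : A} → ¬ P → (if does P? then x else y) ≡ y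
if-no P? {x} {y} ¬p = cong (if_then x else y) (dec-false P? ¬p)

indicator : ∀ {p} {P : Set p} → Dec P → ℕ
indicator P? = if does P? then 1 else 0

indicator-mono : ∀ {p q} {P : Set p} {Q : Set q} (P? : Dec P) (Q? : Dec Q) → (P → Q) → indicator P? ≤ indicator Q?
indicator-mono (yes p) (yes _) _   = ≤-refl
indicator-mono (yes p) (no ¬q) P⇒Q = contradiction (P⇒Q p) ¬q
indicator-mono (no _)  _       _   = z≤n

indicator-< : ∀ {p q} {P : Set p} {Q : Set q} (P? : Dec P) (Q? : Dec Q) → ¬ P → Q → indicator P? < indicator Q?
indicator-< P? Q? ¬p q = subst₂ _<_ (sym (if-no P? ¬p)) (sym (if-yes Q? q)) z<s

indicator-≤1 : ∀ {p} {P : Set p} (P? : Dec P) → indicator P? ≤ 1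
indicator-≤1 (yes _) = ≤-refl
indicator-≤1 (no _)  = z≤n

indicator-pos : ∀ {p} {P : Set p} (P? : Dec P) → 1 ≤ indicator P? → P
indicator-pos (yes p) _ = p

indicator-cong : ∀ {p q} {P : Set p} {Q : Set q} (P? : Dec P) (Q? : Dec Q) → (P → Q) → (Q → P) → indicator P? ≡ indicator Q?
indicator-cong P? Q? P⇒Q Q⇒P = ≤-antisym (indicator-mono P? Q? P⇒Q) (indicator-mono Q? P? Q⇒P)

*-suc-≤ : ∀ {x t} → x ≤ t → x * suc t ≤ suc x * t
*-suc-≤ {x} {t} x≤t = subst (_≤ suc x * t) (sym (*-suc x t)) (+-monoˡ-≤ (x * t) x≤t)

*-suc-≥ : ∀ {x t} → t ≤ x → suc x * t ≤ x * suc t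
*-suc-≥ {x} {t} t≤x = subst (suc x * t ≤_) (sym (*-suc x t)) (+-monoˡ-≤ (x * t) t≤x)

^-distribʳ-* : ∀ m n k → (m * n) ^ k ≡ m ^ k * n ^ k
^-distribʳ-* m n zero    = refl
^-distribʳ-* m n (suc k) = trans (cong (m * n *_) (^-distribʳ-* m n k))
                                 (solve 4 (λ x y u v → x :* y :* (u :* v) := x :* u :* (y :* v)) refl m n (m ^ k) (n ^ k))

*-cancel-≤ : ∀ x y x′ y′ {u v} .{{_ : NonZero u}} .{{_ : NonZero v}} →
             x * u * (y * v) ≤ x′ * u * (y′ * v) → x * y ≤ x′ * y′
*-cancel-≤ x y x′ y′ {u} {v} le = *-cancelʳ-≤ (x * y) (x′ * y′) (u * v) {{m*n≢0 u v}} (subst₂ _≤_ (regroup x y) (regroup x′ y′) le)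
  where
  regroup : ∀ a b → a * u * (b * v) ≡ a * b * (u * v)
  regroup a b = solve 4 (λ a u b v → a :* u :* (b :* v) := a :* b :* (u :* v)) refl a u b v

minimal-witness : ∀ {p} {P : Pred ℕ p} → Decidable P → ∀ n → (∃ λ r → r < n × P r) →
                  ∃ λ r → P r × (∀ {r′} → r′ < r → ¬ P r′)
minimal-witness P? (suc n) (r , r<1+n , Pr) with anyUpTo? P? n
... | yes below = minimal-witness P? n below
... | no  none  = r , Pr , λ r′<r Pr′ → none (_ , <-≤-trans r′<r (≤-pred r<1+n) , Pr′)

foldr-⊔-upperBound : ∀ {x} xs → x ∈ xs → x ≤ foldr _⊔_ 0 xs
foldr-⊔-upperBound (y ∷ ys) (here refl) = m≤m⊔n y _
foldr-⊔-upperBound (y ∷ ys) (there x∈ys) = ≤-trans (foldr-⊔-upperBound ys x∈ys) (m≤n⊔m y _)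

foldr-⊔-selective : ∀ xs → foldr _⊔_ 0 xs ≡ 0 ⊎ foldr _⊔_ 0 xs ∈ xs
foldr-⊔-selective []       = inj₁ refl
foldr-⊔-selective (y ∷ ys) with ⊔-sel y (foldr _⊔_ 0 ys)
... | inj₁ max≡y = inj₂ (here max≡y)
... | inj₂ max≡rest with foldr-⊔-selective ys
...   | inj₁ rest≡0   = inj₁ (trans max≡rest rest≡0)
...   | inj₂ rest∈ys  = inj₂ (there (subst (_∈ ys) (sym max≡rest) rest∈ys))

length-filter : ∀ {a p} {A : Set a} {P : Pred A p} (P? : Decidable P) xs →
                length (filter P? xs) ≡ sum (map (indicator ∘ P?) xs)
length-filter P? []       = refl
length-filter P? (x ∷ xs) with does (P? x)
... | true  = cong suc (length-filter P? xs)
... | false = length-filter P? xs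

sum-map-concatMap : ∀ {a b} {A : Set a} {B : Set b} (g : B → ℕ) (f : A → List B) xs →
                    sum (map g (concatMap f xs)) ≡ sum (map (λ x → sum (map g (f x))) xs)
sum-map-concatMap g f []       = refl
sum-map-concatMap g f (x ∷ xs) = begin
  sum (map g (f x ++ concatMap f xs))             ≡⟨ cong sum (map-++ g (f x) _) ⟩
  sum (map g (f x) ++ map g (concatMap f xs))     ≡⟨ sum-++ (map g (f x)) _ ⟩
  sum (map g (f x)) + sum (map g (concatMap f xs)) ≡⟨ cong (sum (map g (f x)) +_) (sum-map-concatMap g f xs) ⟩
  sum (map g (f x)) + sum (map (λ x → sum (map g (f x))) xs) ∎
  where open ≡-Reasoning

product-concatMap-replicate : ∀ (e : ℕ → ℕ) ps → product (concatMap (λ p → replicate (e p) p) ps) ≡ product (map (λ p → p ^ e p) ps)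
product-concatMap-replicate e []       = refl
product-concatMap-replicate e (p ∷ ps) =
  trans (product-++ (replicate (e p) p) _) (cong₂ _*_ (product-replicate (e p)) (product-concatMap-replicate e ps))
  where
  product-replicate : ∀ k → product (replicate k p) ≡ p ^ k
  product-replicate zero    = refl
  product-replicate (suc k) = cong (p *_) (product-replicate k)

length-concatMap-replicate : ∀ (e : ℕ → ℕ) ps → length (concatMap (λ p → replicate (e p) p) ps) ≡ sum (map e ps)
length-concatMap-replicate e []       = refl
length-concatMap-replicate e (p ∷ ps) =
  trans (length-++ (replicate (e p) p)) (cong₂ _+_ (length-replicate (e p)) (length-concatMap-replicate e ps))

module _ (w : ℕ → ℕ) (c e : ℕ) where

  geometric-growth : ∀ a d → (∀ {i} → a ≤ i → i < a + d → w i * c ≤ w (suc i) * e) → w a * c ^ d ≤ w (a + d) * e ^ d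
  geometric-growth a zero    _    = ≤-reflexive (cong (λ i → w i * 1) (sym (+-identityʳ a)))
  geometric-growth a (suc d) step = begin
    w a * (c * c ^ d)            ≡⟨ solve 3 (λ x y u → x :* (y :* u) := x :* u :* y) refl (w a) c (c ^ d) ⟩
    w a * c ^ d * c              ≤⟨ *-monoˡ-≤ c (geometric-growth a d (λ a≤i i<a+d → step a≤i (<-≤-trans i<a+d (+-monoʳ-≤ a (n≤1+n d))))) ⟩
    w (a + d) * e ^ d * c        ≡⟨ solve 3 (λ x y u → x :* y :* u := x :* u :* y) refl (w (a + d)) (e ^ d) c ⟩
    w (a + d) * c * e ^ d        ≤⟨ *-monoˡ-≤ (e ^ d) (step (m≤m+n a d) (+-monoʳ-< a (n<1+n d))) ⟩
    w (suc (a + d)) * e * e ^ d  ≡⟨ trans (*-assoc (w (suc (a + d))) e (e ^ d)) (cong (λ i → w i * (e * e ^ d)) (sym (+-suc a d))) ⟩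
    w (a + suc d) * (e * e ^ d)  ∎
    where open ≤-Reasoning

  geometric-decay : ∀ a d → (∀ {i} → a ≤ i → i < a + d → w (suc i) * e ≤ w i * c) → w (a + d) * e ^ d ≤ w a * c ^ d
  geometric-decay a zero    _    = ≤-reflexive (cong (λ i → w i * 1) (+-identityʳ a))
  geometric-decay a (suc d) step = begin
    w (a + suc d) * (e * e ^ d)  ≡⟨ trans (cong (λ i → w i * (e * e ^ d)) (+-suc a d)) (sym (*-assoc (w (suc (a + d))) e (e ^ d))) ⟩
    w (suc (a + d)) * e * e ^ d  ≤⟨ *-monoˡ-≤ (e ^ d) (step (m≤m+n a d) (+-monoʳ-< a (n<1+n d))) ⟩
    w (a + d) * c * e ^ d        ≡⟨ solve 3 (λ x y u → x :* u :* y := x :* y :* u) refl (w (a + d)) (e ^ d) c ⟩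
    w (a + d) * e ^ d * c        ≤⟨ *-monoˡ-≤ c (geometric-decay a d (λ a≤i i<a+d → step a≤i (<-≤-trans i<a+d (+-monoʳ-≤ a (n≤1+n d))))) ⟩
    w a * c ^ d * c              ≡⟨ solve 3 (λ x y u → x :* u :* y := x :* (y :* u)) refl (w a) c (c ^ d) ⟩
    w a * (c * c ^ d)            ∎
    where open ≤-Reasoning

module Big {A : Set} {_∙_ : A → A → A} {ε : A} (isCM : IsCommutativeMonoid _≡_ _∙_ ε) where

  open IsCommutativeMonoid isCM using (assoc; identityˡ; identityʳ; isCommutativeSemigroup)

  private
    commutativeSemigroup : CommutativeSemigroup _ _
    commutativeSemigroup = record { isCommutativeSemigroup = isCommutativeSemigroup }

  open CommutativeSemigroupProperties commutativeSemigroup using (interchange)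

  big : ℕ → (ℕ → A) → A
  big zero    f = ε
  big (suc n) f = big n f ∙ f (suc n)

  bigₚ : ℕ → (ℕ → A) → A
  bigₚ n f = big n (λ q → if does (prime? q) then f q else ε)

  big-cong : ∀ n {f g} → (∀ {i} → 1 ≤ i → i ≤ n → f i ≡ g i) → big n f ≡ big n g
  big-cong zero    eq = refl
  big-cong (suc n) eq = cong₂ _∙_ (big-cong n (λ 1≤i i≤n → eq 1≤i (m≤n⇒m≤1+n i≤n))) (eq z<s ≤-refl)

  big-identity : ∀ n {f} → (∀ {i} → 1 ≤ i → i ≤ n → f i ≡ ε) → big n f ≡ ε
  big-identity n {f} eq = trans (big-cong n eq) (big-ε n)
    where
    big-ε : ∀ n → big n (λ _ → ε) ≡ ε
    big-ε zero    = refl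
    big-ε (suc n) = trans (identityʳ _) (big-ε n)

  big-∙ : ∀ n f g → big n (λ i → f i ∙ g i) ≡ big n f ∙ big n g
  big-∙ zero    f g = sym (identityˡ ε)
  big-∙ (suc n) f g = trans (cong (_∙ (f (suc n) ∙ g (suc n))) (big-∙ n f g))
                            (interchange (big n f) (big n g) (f (suc n)) (g (suc n)))

  big-head : ∀ n f → big (suc n) f ≡ f 1 ∙ big n (f ∘ suc)
  big-head zero    f = trans (identityˡ (f 1)) (sym (identityʳ (f 1)))
  big-head (suc n) f = trans (cong (_∙ f (2 + n)) (big-head n f)) (assoc (f 1) _ _)

  big-ext : ∀ {a b} f → a ≤ b → (∀ {i} → a < i → i ≤ b → f i ≡ ε) → big b f ≡ big a f
  big-ext {b = zero}  f z≤n vanish = refl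
  big-ext {a} {suc b} f a≤1+b vanish with m≤n⇒m<n∨m≡n a≤1+b
  ... | inj₂ refl = refl
  ... | inj₁ a<1+b = begin
    big b f ∙ f (suc b) ≡⟨ cong (big b f ∙_) (vanish a<1+b ≤-refl) ⟩
    big b f ∙ ε         ≡⟨ identityʳ (big b f) ⟩
    big b f             ≡⟨ big-ext f (≤-pred a<1+b) (λ a<i i≤b → vanish a<i (m≤n⇒m≤1+n i≤b)) ⟩
    big a f             ∎
    where open ≡-Reasoning

  big-delta : ∀ n {f} x → 1 ≤ x → x ≤ n → (∀ {i} → 1 ≤ i → i ≤ n → i ≢ x → f i ≡ ε) → big n f ≡ f x
  big-delta zero        x 1≤x x≤0   _      = contradiction x≤0 (<⇒≱ 1≤x)
  big-delta (suc n) {f} x 1≤x x≤1+n vanish with x ≟ suc n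
  ... | yes refl = trans (cong (_∙ f x) (big-identity n (λ 1≤i i≤n → vanish 1≤i (m≤n⇒m≤1+n i≤n) (<⇒≢ (s≤s i≤n)))))
                         (identityˡ (f x))
  ... | no x≢1+n = trans (cong₂ _∙_ (big-delta n x 1≤x (≤-pred (≤∧≢⇒< x≤1+n x≢1+n))
                                      (λ 1≤i i≤n → vanish 1≤i (m≤n⇒m≤1+n i≤n)))
                                    (vanish z<s ≤-refl (x≢1+n ∘ sym)))
                         (identityʳ (f x))

  big-split : ∀ a b f → big (a + b) f ≡ big a f ∙ big b (λ j → f (a + j))
  big-split a zero    f = trans (cong (λ n → big n f) (+-identityʳ a)) (sym (identityʳ (big a f)))
  big-split a (suc b) f = begin
    big (a + suc b) f                                  ≡⟨ cong (λ n → big n f) (+-suc a b) ⟩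
    big (a + b) f ∙ f (suc (a + b))                    ≡⟨ cong₂ _∙_ (big-split a b f) (cong f (sym (+-suc a b))) ⟩
    (big a f ∙ big b (λ j → f (a + j))) ∙ f (a + suc b) ≡⟨ assoc (big a f) _ _ ⟩
    big a f ∙ big (suc b) (λ j → f (a + j))            ∎
    where open ≡-Reasoning

  foldr-applyUpTo : ∀ n f → foldr _∙_ ε (applyUpTo (f ∘ suc) n) ≡ big n f
  foldr-applyUpTo zero    f = refl
  foldr-applyUpTo (suc n) f = trans (cong (f 1 ∙_) (foldr-applyUpTo n (f ∘ suc))) (sym (big-head n f))

  foldr-map-filter : ∀ {b p} {B : Set b} {P : Pred B p} (P? : Decidable P) (f : B → A) xs →
    foldr _∙_ ε (map f (filter P? xs)) ≡ foldr _∙_ ε (map (λ x → if does (P? x) then f x else ε) xs)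
  foldr-map-filter P? f []       = refl
  foldr-map-filter P? f (x ∷ xs) with does (P? x)
  ... | true  = cong (f x ∙_) (foldr-map-filter P? f xs)
  ... | false = trans (foldr-map-filter P? f xs) (sym (identityˡ _))

  foldr-map-primesTo : ∀ n f → foldr _∙_ ε (map f (filter prime? (upTo (suc n)))) ≡ bigₚ n f
  foldr-map-primesTo n f = begin
    foldr _∙_ ε (map f (filter prime? (upTo (suc n))))                    ≡⟨ foldr-map-filter prime? f (upTo (suc n)) ⟩
    ε ∙ foldr _∙_ ε (map (λ q → if does (prime? q) then f q else ε) (applyUpTo suc n))
                                                                          ≡⟨ identityˡ _ ⟩
    foldr _∙_ ε (map (λ q → if does (prime? q) then f q else ε) (applyUpTo suc n))
                                                                          ≡⟨ cong (foldr _∙_ ε) (map-applyUpTo suc _ n) ⟩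
    foldr _∙_ ε (applyUpTo (λ q → if does (prime? (suc q)) then f (suc q) else ε) n)
                                                                          ≡⟨ foldr-applyUpTo n _ ⟩
    bigₚ n f                                                              ∎
    where open ≡-Reasoning

  bigₚ-cong : ∀ n {f g} → (∀ {q} → Prime q → q ≤ n → f q ≡ g q) → bigₚ n f ≡ bigₚ n g
  bigₚ-cong n {f} {g} eq = big-cong n pointwise
    where
    pointwise : ∀ {q} → 1 ≤ q → q ≤ n → (if does (prime? q) then f q else ε) ≡ (if does (prime? q) then g q else ε)
    pointwise {q} _ q≤n with prime? q
    ... | yes pq = eq pq q≤n
    ... | no _   = refl

  bigₚ-identity : ∀ n {f} → (∀ {q} → Prime q → q ≤ n → f q ≡ ε) → bigₚ n f ≡ ε
  bigₚ-identity n {f} vanish = big-identity n pointwise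
    where
    pointwise : ∀ {q} → 1 ≤ q → q ≤ n → (if does (prime? q) then f q else ε) ≡ ε
    pointwise {q} _ q≤n with prime? q
    ... | yes pq = vanish pq q≤n
    ... | no _   = refl

  bigₚ-∙ : ∀ n f g → bigₚ n (λ q → f q ∙ g q) ≡ bigₚ n f ∙ bigₚ n g
  bigₚ-∙ n f g = trans (big-cong n pointwise) (big-∙ n _ _)
    where
    pointwise : ∀ {q} → 1 ≤ q → q ≤ n → (if does (prime? q) then f q ∙ g q else ε)
                  ≡ (if does (prime? q) then f q else ε) ∙ (if does (prime? q) then g q else ε)
    pointwise {q} _ _ with does (prime? q)
    ... | true  = refl
    ... | false = sym (identityˡ ε)

  bigₚ-ext : ∀ {a b} f → a ≤ b → (∀ {q} → Prime q → a < q → q ≤ b → f q ≡ ε) → bigₚ b f ≡ bigₚ a f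
  bigₚ-ext {a} {b} f a≤b vanish = big-ext _ a≤b pointwise
    where
    pointwise : ∀ {q} → a < q → q ≤ b → (if does (prime? q) then f q else ε) ≡ ε
    pointwise {q} a<q q≤b with prime? q
    ... | yes pq = vanish pq a<q q≤b
    ... | no _   = refl

  bigₚ-delta : ∀ n {f} {x} → Prime x → x ≤ n → (∀ {q} → Prime q → q ≤ n → q ≢ x → f q ≡ ε) → bigₚ n f ≡ f x
  bigₚ-delta n {f} {x} px x≤n vanish =
    trans (big-delta n x (prime⇒1≤ px) x≤n pointwise) (if-yes (prime? x) px)
    where
    prime⇒1≤ : ∀ {p} → Prime p → 1 ≤ p
    prime⇒1≤ {suc _} _ = s≤s z≤n
    pointwise : ∀ {q} → 1 ≤ q → q ≤ n → q ≢ x → (if does (prime? q) then f q else ε) ≡ ε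
    pointwise {q} _ q≤n q≢x with prime? q
    ... | yes pq = vanish pq q≤n q≢x
    ... | no _   = refl

module ∑ where

  open Big +-0-isCommutativeMonoid public

  big-mono : ∀ n {f g} → (∀ {i} → 1 ≤ i → i ≤ n → f i ≤ g i) → big n f ≤ big n g
  big-mono zero    le = z≤n
  big-mono (suc n) le = +-mono-≤ (big-mono n (λ 1≤i i≤n → le 1≤i (m≤n⇒m≤1+n i≤n))) (le z<s ≤-refl)

  big-< : ∀ n {f g} → (∀ {i} → 1 ≤ i → i ≤ n → f i ≤ g i) →
          ∀ {j} → 1 ≤ j → j ≤ n → f j < g j → big n f < big n g
  big-< zero    le 1≤j j≤0 _ = contradiction j≤0 (<⇒≱ 1≤j)
  big-< (suc n) le {j} 1≤j j≤1+n fj<gj with j ≟ suc n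
  ... | yes refl = +-mono-≤-< (big-mono n le′) fj<gj
    where le′ = λ {i} 1≤i i≤n → le {i} 1≤i (m≤n⇒m≤1+n i≤n)
  ... | no j≢1+n = +-mono-<-≤ (big-< n le′ 1≤j (≤-pred (≤∧≢⇒< j≤1+n j≢1+n)) fj<gj) (le z<s ≤-refl)
    where le′ = λ {i} 1≤i i≤n → le {i} 1≤i (m≤n⇒m≤1+n i≤n)

  big-*ˡ : ∀ n c f → big n (λ i → c * f i) ≡ c * big n f
  big-*ˡ zero    c f = sym (*-zeroʳ c)
  big-*ˡ (suc n) c f = trans (cong (_+ c * f (suc n)) (big-*ˡ n c f)) (sym (*-distribˡ-+ c _ _))

  big-pos : ∀ n {f} → 1 ≤ big n f → ∃ λ i → 1 ≤ i × i ≤ n × 1 ≤ f i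
  big-pos zero      ()
  big-pos (suc n) {f} pos with 1 ≤? f (suc n)
  ... | yes 1≤f = suc n , z<s , ≤-refl , 1≤f
  ... | no  1≰f with big-pos n (subst (1 ≤_) (trans (cong (big n f +_) (n<1⇒n≡0 (≰⇒> 1≰f))) (+-identityʳ _)) pos)
  ...   | i , 1≤i , i≤n , 1≤fi = i , 1≤i , m≤n⇒m≤1+n i≤n , 1≤fi

  big-≤1 : ∀ n {f} → (∀ {i} → 1 ≤ i → i ≤ n → f i ≤ 1) →
           (∀ {i j} → 1 ≤ i → i ≤ n → 1 ≤ j → j ≤ n → 1 ≤ f i → 1 ≤ f j → i ≡ j) → big n f ≤ 1
  big-≤1 n {f} ≤1 unique with 1 ≤? big n f
  ... | no  1≰big = ≤-trans (≤-pred (≰⇒> 1≰big)) z≤n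
  ... | yes 1≤big with big-pos n 1≤big
  ...   | i , 1≤i , i≤n , 1≤fi = subst (_≤ 1) (sym (big-delta n i 1≤i i≤n vanish)) (≤1 1≤i i≤n)
    where
    vanish : ∀ {j} → 1 ≤ j → j ≤ n → j ≢ i → f j ≡ 0
    vanish 1≤j j≤n j≢i = n<1⇒n≡0 (≰⇒> (λ 1≤fj → j≢i (unique 1≤j j≤n 1≤i i≤n 1≤fj 1≤fi)))

  big-multiples : ∀ p .{{_ : NonZero p}} n f → (∀ {d} → ¬ p ∣ d → f d ≡ 0) →
                  big (p * n) f ≡ big n (λ e → f (p * e))
  big-multiples p zero    f vanish = cong (λ m → big m f) (*-zeroʳ p)
  big-multiples p (suc n) f vanish = begin
    big (p * suc n) f                                 ≡⟨ cong (λ m → big m f) (trans (*-suc p n) (+-comm p (p * n))) ⟩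
    big (p * n + p) f                                 ≡⟨ big-split (p * n) p f ⟩
    big (p * n) f + big p (λ j → f (p * n + j))        ≡⟨ cong₂ _+_ (big-multiples p n f vanish) last-multiple ⟩
    big n (λ e → f (p * e)) + f (p * suc n)           ∎
    where
    open ≡-Reasoning
    last-multiple : big p (λ j → f (p * n + j)) ≡ f (p * suc n)
    last-multiple = trans (big-delta p p (>-nonZero⁻¹ p) ≤-refl
                             (λ 1≤j j≤p j≢p → vanish (λ p∣ → <⇒≱ (≤∧≢⇒< j≤p j≢p)
                               (∣⇒≤ {{>-nonZero 1≤j}} (∣m+n∣m⇒∣n p∣ (m∣m*n n))))))
                          (cong f (trans (+-comm (p * n) p) (sym (*-suc p n))))

  bigₚ-mono : ∀ n {f g} → (∀ {q} → Prime q → q ≤ n → f q ≤ g q) → bigₚ n f ≤ bigₚ n g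
  bigₚ-mono n {f} {g} le = big-mono n pointwise
    where
    pointwise : ∀ {q} → 1 ≤ q → q ≤ n → (if does (prime? q) then f q else 0) ≤ (if does (prime? q) then g q else 0)
    pointwise {q} _ q≤n with prime? q
    ... | yes pq = le pq q≤n
    ... | no _   = z≤n

  bigₚ-< : ∀ n {f g} → (∀ {q} → Prime q → q ≤ n → f q ≤ g q) →
           ∀ {p} → Prime p → p ≤ n → f p < g p → bigₚ n f < bigₚ n g
  bigₚ-< n {f} {g} le {p} pp p≤n fp<gp =
    big-< n pointwise (>-nonZero⁻¹ p {{prime⇒nonZero pp}}) p≤n
      (subst₂ _<_ (sym (if-yes (prime? p) pp)) (sym (if-yes (prime? p) pp)) fp<gp)
    where
    pointwise : ∀ {q} → 1 ≤ q → q ≤ n → (if does (prime? q) then f q else 0) ≤ (if does (prime? q) then g q else 0)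
    pointwise {q} _ q≤n with prime? q
    ... | yes pq = le pq q≤n
    ... | no _   = z≤n

  bigₚ-≤1 : ∀ n {f} → (∀ {q} → Prime q → q ≤ n → f q ≤ 1) →
            (∀ {q q′} → Prime q → q ≤ n → Prime q′ → q′ ≤ n → 1 ≤ f q → 1 ≤ f q′ → q ≡ q′) → bigₚ n f ≤ 1
  bigₚ-≤1 n {f} ≤1 unique = big-≤1 n pointwise unique′
    where
    g : ℕ → ℕ
    g q = if does (prime? q) then f q else 0
    pointwise : ∀ {q} → 1 ≤ q → q ≤ n → g q ≤ 1
    pointwise {q} _ q≤n with prime? q
    ... | yes pq = ≤1 pq q≤n
    ... | no _   = z≤n
    positive : ∀ q → 1 ≤ g q → Prime q × 1 ≤ f q
    positive q 1≤gq with prime? q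
    ... | yes pq = pq , 1≤gq
    unique′ : ∀ {q q′} → 1 ≤ q → q ≤ n → 1 ≤ q′ → q′ ≤ n → 1 ≤ g q → 1 ≤ g q′ → q ≡ q′
    unique′ {q} {q′} _ q≤n _ q′≤n 1≤gq 1≤gq′ with positive q 1≤gq | positive q′ 1≤gq′
    ... | pq , 1≤fq | pq′ , 1≤fq′ = unique pq q≤n pq′ q′≤n 1≤fq 1≤fq′

module ∏ where

  open Big *-1-isCommutativeMonoid public

  big-mono : ∀ n {f g} → (∀ {i} → 1 ≤ i → i ≤ n → f i ≤ g i) → big n f ≤ big n g
  big-mono zero    le = ≤-refl
  big-mono (suc n) le = *-mono-≤ (big-mono n (λ 1≤i i≤n → le 1≤i (m≤n⇒m≤1+n i≤n))) (le z<s ≤-refl)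

  bigₚ-mono : ∀ n {f g} → (∀ {q} → Prime q → q ≤ n → f q ≤ g q) → bigₚ n f ≤ bigₚ n g
  bigₚ-mono n {f} {g} le = big-mono n pointwise
    where
    pointwise : ∀ {q} → 1 ≤ q → q ≤ n → (if does (prime? q) then f q else 1) ≤ (if does (prime? q) then g q else 1)
    pointwise {q} _ q≤n with prime? q
    ... | yes pq = le pq q≤n
    ... | no _   = ≤-refl

  big-^ : ∀ n c f → big n (λ i → c ^ f i) ≡ c ^ ∑.big n f
  big-^ zero    c f = refl
  big-^ (suc n) c f = trans (cong (_* c ^ f (suc n)) (big-^ n c f)) (sym (^-distribˡ-+-* c (∑.big n f) (f (suc n))))

  bigₚ-^ : ∀ n c f → bigₚ n (λ q → c ^ f q) ≡ c ^ ∑.bigₚ n f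
  bigₚ-^ n c f = trans (big-cong n pointwise) (big-^ n c _)
    where
    pointwise : ∀ {q} → 1 ≤ q → q ≤ n → (if does (prime? q) then c ^ f q else 1) ≡ c ^ (if does (prime? q) then f q else 0)
    pointwise {q} _ _ with does (prime? q)
    ... | true  = refl
    ... | false = refl

z≡∑ : ∀ q k → z q k ≡ ∑.big k (q ^_)
z≡∑ q k = trans (cong sum (map-applyUpTo suc (q ^_) k)) (∑.foldr-applyUpTo k (q ^_))

z-suc : ∀ q k → z q (suc k) ≡ z q k + q ^ suc k
z-suc q k = trans (z≡∑ q (suc k)) (cong (_+ q ^ suc k) (sym (z≡∑ q k)))

z-suc-Horner : ∀ q k → z q (suc k) ≡ q * suc (z q k)
z-suc-Horner q k = begin
  z q (suc k)                        ≡⟨ z≡∑ q (suc k) ⟩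
  ∑.big (suc k) (q ^_)               ≡⟨ ∑.big-head k (q ^_) ⟩
  q * 1 + ∑.big k (λ i → q * q ^ i)  ≡⟨ cong (q * 1 +_) (∑.big-*ˡ k q (q ^_)) ⟩
  q * 1 + q * ∑.big k (q ^_)         ≡⟨ sym (*-distribˡ-+ q 1 _) ⟩
  q * suc (∑.big k (q ^_))           ≡⟨ cong (λ x → q * suc x) (sym (z≡∑ q k)) ⟩
  q * suc (z q k)                    ∎
  where open ≡-Reasoning

z-one : ∀ q → z q 1 ≡ q
z-one q = trans (+-identityʳ (q * 1)) (*-identityʳ q)

module _ {q} .{{_ : NonZero q}} where

  z-<-suc : ∀ k → z q k < z q (suc k)
  z-<-suc k = subst (z q k <_) (sym (z-suc q k)) (m<m+n (z q k) (m^n>0 q (suc k)))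

  z-< : ∀ {k j} → k < j → z q k < z q j
  z-< {k} {suc j} k<1+j with m≤n⇒m<n∨m≡n (≤-pred k<1+j)
  ... | inj₁ k<j  = <-trans (z-< k<j) (z-<-suc j)
  ... | inj₂ refl = z-<-suc k

  z-mono : ∀ {k j} → k ≤ j → z q k ≤ z q j
  z-mono k≤j with m≤n⇒m<n∨m≡n k≤j
  ... | inj₁ k<j  = <⇒≤ (z-< k<j)
  ... | inj₂ refl = ≤-refl

  z-injective : ∀ {k j} → z q k ≡ z q j → k ≡ j
  z-injective {k} {j} eq with <-cmp k j
  ... | tri< k<j _ _ = contradiction eq (<⇒≢ (z-< k<j))
  ... | tri≈ _ k≡j _ = k≡j
  ... | tri> _ _ j<k = contradiction (sym eq) (<⇒≢ (z-< j<k))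

  k≤z : ∀ k → k ≤ z q k
  k≤z zero    = z≤n
  k≤z (suc k) = ≤-<-trans (k≤z k) (z-<-suc k)

  q≤z : ∀ {k} → 1 ≤ k → q ≤ z q k
  q≤z {k} 1≤k = subst (_≤ z q k) (z-one q) (z-mono 1≤k)

z-suc-Horner-* : ∀ q i x → suc (z q i) * (q * x) ≡ z q (suc i) * x
z-suc-Horner-* q i x = trans (solve 3 (λ w q x → w :* (q :* x) := q :* w :* x) refl (suc (z q i)) q x)
                             (cong (_* x) (sym (z-suc-Horner q i)))

-- The divisor sum of p ^ a * r

divisorOf : ℕ → ℕ → ℕ
divisorOf n d = if does (d ∣? n) then d else 0

σ≡∑ : ∀ n → σ n ≡ ∑.big n (divisorOf n)
σ≡∑ n = begin
  sum (filter (_∣? n) (applyUpTo suc n))                      ≡⟨ cong sum (sym (map-id (filter (_∣? n) (applyUpTo suc n)))) ⟩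
  sum (map id (filter (_∣? n) (applyUpTo suc n)))             ≡⟨ ∑.foldr-map-filter (_∣? n) id (applyUpTo suc n) ⟩
  sum (map (divisorOf n) (applyUpTo suc n))                   ≡⟨ cong sum (map-applyUpTo suc (divisorOf n) n) ⟩
  sum (applyUpTo (divisorOf n ∘ suc) n)                       ≡⟨ ∑.foldr-applyUpTo n (divisorOf n) ⟩
  ∑.big n (divisorOf n)                                       ∎
  where open ≡-Reasoning

σ∣ σ∤ : ℕ → ℕ → ℕ
σ∣ p n = ∑.big n (λ d → if does (p ∣? d) then divisorOf n d else 0)
σ∤ p n = ∑.big n (λ d → if does (p ∣? d) then 0 else divisorOf n d)

σ≡σ∣+σ∤ : ∀ p n → σ n ≡ σ∣ p n + σ∤ p n
σ≡σ∣+σ∤ p n = trans (σ≡∑ n) (trans (∑.big-cong n (λ {d} _ _ → split d)) (∑.big-∙ n _ _))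
  where
  split : ∀ d → divisorOf n d ≡ (if does (p ∣? d) then divisorOf n d else 0) + (if does (p ∣? d) then 0 else divisorOf n d)
  split d with does (p ∣? d)
  ... | true  = sym (+-identityʳ _)
  ... | false = refl

σ∣-* : ∀ p .{{_ : NonZero p}} n → σ∣ p (p * n) ≡ p * σ n
σ∣-* p n = begin
  σ∣ p (p * n)                        ≡⟨ ∑.big-multiples p n _ (λ {d} p∤d → if-no (p ∣? d) p∤d) ⟩
  ∑.big n (λ e → if does (p ∣? p * e) then divisorOf (p * n) (p * e) else 0)
                                      ≡⟨ ∑.big-cong n (λ {e} _ _ → trans (if-yes (p ∣? p * e) (m∣m*n e)) (scaled e)) ⟩
  ∑.big n (λ e → p * divisorOf n e)   ≡⟨ ∑.big-*ˡ n p (divisorOf n) ⟩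
  p * ∑.big n (divisorOf n)           ≡⟨ cong (p *_) (sym (σ≡∑ n)) ⟩
  p * σ n                             ∎
  where
  open ≡-Reasoning
  scaled : ∀ e → divisorOf (p * n) (p * e) ≡ p * divisorOf n e
  scaled e with e ∣? n
  ... | yes e∣n = if-yes (p * e ∣? p * n) (*-monoʳ-∣ p e∣n)
  ... | no  e∤n = trans (if-no (p * e ∣? p * n) (e∤n ∘ *-cancelˡ-∣ p)) (sym (*-zeroʳ p))

prime∤⇒coprime : ∀ {p d} → Prime p → ¬ p ∣ d → Coprime d p
prime∤⇒coprime pp p∤d (i∣d , i∣p) with prime⇒irreducible pp i∣p
... | inj₁ i≡1 = i≡1
... | inj₂ refl = contradiction i∣d p∤d

σ∤-* : ∀ {p} → Prime p → ∀ n .{{_ : NonZero n}} → σ∤ p (p * n) ≡ σ∤ p n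
σ∤-* {p} pp n = trans (∑.big-cong (p * n) (λ {d} _ _ → pointwise d))
                      (∑.big-ext _ (m≤n*m n p {{prime⇒nonZero pp}}) (λ {d} n<d _ → beyond d n<d))
  where
  pointwise : ∀ d → (if does (p ∣? d) then 0 else divisorOf (p * n) d) ≡ (if does (p ∣? d) then 0 else divisorOf n d)
  pointwise d with p ∣? d
  ... | yes _   = refl
  ... | no  p∤d with d ∣? n
  ...   | yes d∣n = if-yes (d ∣? p * n) (∣n⇒∣m*n p d∣n)
  ...   | no  d∤n = if-no (d ∣? p * n) (d∤n ∘ coprime-divisor (prime∤⇒coprime pp p∤d))
  beyond : ∀ d → n < d → (if does (p ∣? d) then 0 else divisorOf n d) ≡ 0
  beyond d n<d with does (p ∣? d)
  ... | true  = refl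
  ... | false = if-no (d ∣? n) (<⇒≱ n<d ∘ ∣⇒≤)

σ∣-coprime : ∀ {p r} → ¬ p ∣ r → σ∣ p r ≡ 0
σ∣-coprime {p} {r} p∤r = ∑.big-identity r (λ {d} _ _ → pointwise d)
  where
  pointwise : ∀ d → (if does (p ∣? d) then divisorOf r d else 0) ≡ 0
  pointwise d with p ∣? d
  ... | yes p∣d = if-no (d ∣? r) (p∤r ∘ ∣-trans p∣d)
  ... | no  _   = refl

module _ {p r} (pp : Prime p) .{{_ : NonZero r}} (p∤r : ¬ p ∣ r) where

  private instance _ = prime⇒nonZero pp

  σ∤[p^a*r]   : ∀ a → σ∤ p (p ^ a * r) ≡ σ r
  σ∤[p^1+a*r] : ∀ a → σ∤ p (p * (p ^ a * r)) ≡ σ r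

  σ∤[p^a*r] zero    = begin
    σ∤ p (1 * r)          ≡⟨ cong (σ∤ p) (*-identityˡ r) ⟩
    σ∤ p r                ≡⟨ sym (cong (_+ σ∤ p r) (σ∣-coprime p∤r)) ⟩
    σ∣ p r + σ∤ p r       ≡⟨ sym (σ≡σ∣+σ∤ p r) ⟩
    σ r                   ∎
    where open ≡-Reasoning
  σ∤[p^a*r] (suc a) = trans (cong (σ∤ p) (*-assoc p (p ^ a) r)) (σ∤[p^1+a*r] a)

  σ∤[p^1+a*r] a = trans (σ∤-* pp (p ^ a * r) {{m*n≢0 (p ^ a) r {{m^n≢0 p a}}}}) (σ∤[p^a*r] a)

  σ[p^a*r] : ∀ a → σ (p ^ a * r) ≡ suc (z p a) * σ r
  σ[p^a*r] zero    = trans (cong σ (*-identityˡ r)) (sym (+-identityʳ (σ r)))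
  σ[p^a*r] (suc a) = begin
    σ (p * p ^ a * r)                          ≡⟨ cong σ (*-assoc p (p ^ a) r) ⟩
    σ (p * (p ^ a * r))                        ≡⟨ σ≡σ∣+σ∤ p (p * (p ^ a * r)) ⟩
    σ∣ p (p * (p ^ a * r)) + σ∤ p (p * (p ^ a * r))
                                               ≡⟨ cong₂ _+_ (σ∣-* p (p ^ a * r)) (σ∤[p^1+a*r] a) ⟩
    p * σ (p ^ a * r) + σ r                    ≡⟨ cong (λ x → p * x + σ r) (σ[p^a*r] a) ⟩
    p * (suc (z p a) * σ r) + σ r              ≡⟨ solve 3 (λ p w s → p :* (w :* s) :+ s := (con 1 :+ p :* w) :* s) refl p (suc (z p a)) (σ r) ⟩
    suc (p * suc (z p a)) * σ r                ≡⟨ cong (λ x → suc x * σ r) (sym (z-suc-Horner p a)) ⟩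
    suc (z p (suc a)) * σ r                    ∎
    where open ≡-Reasoning

-- Products of primes as exponent vectors

multiplicity : ℕ → List ℕ → ℕ
multiplicity q []       = 0
multiplicity q (p ∷ ps) = indicator (q ≟ p) + multiplicity q ps

∏ₚ-^-indicator : ∀ {B p} → Prime p → p ≤ B → ∏.bigₚ B (λ q → q ^ indicator (q ≟ p)) ≡ p
∏ₚ-^-indicator {B} {p} pp p≤B =
  trans (∏.bigₚ-delta B pp p≤B (λ {q} _ _ q≢p → cong (q ^_) (if-no (q ≟ p) q≢p)))
        (trans (cong (p ^_) (if-yes (p ≟ p) refl)) (*-identityʳ p))

∑ₚ-indicator : ∀ {B p} → Prime p → p ≤ B → ∑.bigₚ B (λ q → indicator (q ≟ p)) ≡ 1
∑ₚ-indicator {B} {p} pp p≤B = trans (∑.bigₚ-delta B pp p≤B (λ {q} _ _ q≢p → if-no (q ≟ p) q≢p)) (if-yes (p ≟ p) refl)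

product≡∏ₚ : ∀ {B ps} → All Prime ps → All (_≤ B) ps → product ps ≡ ∏.bigₚ B (λ q → q ^ multiplicity q ps)
product≡∏ₚ {B} []         []         = sym (∏.bigₚ-identity B (λ _ _ → refl))
product≡∏ₚ {B} {p ∷ ps} (pp ∷ pps) (p≤B ∷ ps≤B) = begin
  p * product ps                                       ≡⟨ cong₂ _*_ (sym (∏ₚ-^-indicator pp p≤B)) (product≡∏ₚ pps ps≤B) ⟩
  ∏.bigₚ B (λ q → q ^ indicator (q ≟ p)) * ∏.bigₚ B (λ q → q ^ multiplicity q ps)
                                                       ≡⟨ sym (∏.bigₚ-∙ B _ _) ⟩
  ∏.bigₚ B (λ q → q ^ indicator (q ≟ p) * q ^ multiplicity q ps)
                                                       ≡⟨ ∏.bigₚ-cong B (λ {q} _ _ → sym (^-distribˡ-+-* q (indicator (q ≟ p)) _)) ⟩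
  ∏.bigₚ B (λ q → q ^ multiplicity q (p ∷ ps))         ∎
  where open ≡-Reasoning

length≡∑ₚ : ∀ {B ps} → All Prime ps → All (_≤ B) ps → length ps ≡ ∑.bigₚ B (λ q → multiplicity q ps)
length≡∑ₚ {B} []         []         = sym (∑.bigₚ-identity B (λ _ _ → refl))
length≡∑ₚ {B} {p ∷ ps} (pp ∷ pps) (p≤B ∷ ps≤B) = begin
  1 + length ps                                        ≡⟨ cong₂ _+_ (sym (∑ₚ-indicator pp p≤B)) (length≡∑ₚ pps ps≤B) ⟩
  ∑.bigₚ B (λ q → indicator (q ≟ p)) + ∑.bigₚ B (λ q → multiplicity q ps)
                                                       ≡⟨ sym (∑.bigₚ-∙ B _ _) ⟩
  ∑.bigₚ B (λ q → multiplicity q (p ∷ ps))             ∎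
  where open ≡-Reasoning

prime∣^⇒prime∣ : ∀ {p m} n → Prime p → p ∣ m ^ n → p ∣ m
prime∣^⇒prime∣ zero    pp p∣1 = contradiction (∣1⇒≡1 p∣1) (λ { refl → ¬prime[1] pp })
prime∣^⇒prime∣ {m = m} (suc n) pp p∣m^1+n with euclidsLemma m (m ^ n) pp p∣m^1+n
... | inj₁ p∣m   = p∣m
... | inj₂ p∣m^n = prime∣^⇒prime∣ n pp p∣m^n

prime∣ifPrime^⇒prime∣ : ∀ {p} n e → Prime p → p ∣ (if does (prime? n) then n ^ e else 1) → p ∣ n
prime∣ifPrime^⇒prime∣ n e pp p∣ with does (prime? n)
... | true  = prime∣^⇒prime∣ e pp p∣
... | false = contradiction (∣1⇒≡1 p∣) (λ { refl → ¬prime[1] pp })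

prime∤∏ₚ : ∀ {p} → Prime p → ∀ B (a : ℕ → ℕ) → B < p → ¬ p ∣ ∏.bigₚ B (λ q → q ^ a q)
prime∤∏ₚ pp zero    a _   p∣1 = contradiction (∣1⇒≡1 p∣1) (λ { refl → ¬prime[1] pp })
prime∤∏ₚ pp (suc B) a B<p p∣∏ with euclidsLemma (∏.bigₚ B (λ q → q ^ a q)) _ pp p∣∏
... | inj₁ p∣∏′  = prime∤∏ₚ pp B a (<-trans (n<1+n B) B<p) p∣∏′
... | inj₂ p∣last = <⇒≱ B<p (∣⇒≤ (prime∣ifPrime^⇒prime∣ (suc B) (a (suc B)) pp p∣last))

∏ₚ-^-nonZero : ∀ B (a : ℕ → ℕ) → NonZero (∏.bigₚ B (λ q → q ^ a q))
∏ₚ-^-nonZero zero    a = _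
∏ₚ-^-nonZero (suc B) a with prime? (suc B)
... | yes _ = m*n≢0 _ _ {{∏ₚ-^-nonZero B a}} {{m^n≢0 (suc B) (a (suc B))}}
... | no  _ = m*n≢0 _ 1 {{∏ₚ-^-nonZero B a}}

σ-∏ₚ : ∀ B (a : ℕ → ℕ) → σ (∏.bigₚ B (λ q → q ^ a q)) ≡ ∏.bigₚ B (λ q → suc (z q (a q)))
σ-∏ₚ zero    a = refl
σ-∏ₚ (suc B) a with prime? (suc B)
... | yes pB = begin
  σ (X * p ^ e)           ≡⟨ cong σ (*-comm X (p ^ e)) ⟩
  σ (p ^ e * X)           ≡⟨ σ[p^a*r] pB {{∏ₚ-^-nonZero B a}} (prime∤∏ₚ pB B a ≤-refl) e ⟩
  suc (z p e) * σ X       ≡⟨ *-comm (suc (z p e)) (σ X) ⟩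
  σ X * suc (z p e)       ≡⟨ cong (_* suc (z p e)) (σ-∏ₚ B a) ⟩
  ∏.bigₚ B (λ q → suc (z q (a q))) * suc (z p e) ∎
  where
  open ≡-Reasoning
  X p e : ℕ
  X = ∏.bigₚ B (λ q → q ^ a q)
  p = suc B
  e = a (suc B)
... | no  _ = trans (cong σ (*-identityʳ (∏.bigₚ B (λ q → q ^ a q)))) (trans (σ-∏ₚ B a) (sym (*-identityʳ _)))

All-≤-product : ∀ {ps} → All Prime ps → All (_≤ product ps) ps
All-≤-product []                 = []
All-≤-product {p ∷ ps} (pp ∷ pps) =
  m≤m*n p (product ps) {{productOfPrimes≢0 pps}} ∷
  All.map (λ q≤ → ≤-trans q≤ (m≤n*m (product ps) p {{prime⇒nonZero pp}})) (All-≤-product pps)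

2≤product : ∀ {ps} → All Prime ps → 1 ≤ length ps → 2 ≤ product ps
2≤product {p ∷ ps} (pp ∷ pps) _ = *-mono-≤ (nonTrivial⇒n>1 p {{prime⇒nonTrivial pp}}) (productOfPrimes≥1 pps)

-- Ranks of pairs

ValidPair : ℕ → ℕ → Set
ValidPair q k = Prime q × 1 ≤ k

Before⇒z≤ : ∀ q k p j → Before q k p j → z q k ≤ z p j
Before⇒z≤ q k p j (inj₁ z<z)       = <⇒≤ z<z
Before⇒z≤ q k p j (inj₂ (z≡z , _)) = ≤-reflexive z≡z

Before-trans : ∀ q k p j r l → Before q k p j → Before p j r l → Before q k r l
Before-trans q k p j r l (inj₁ z<z)         b = inj₁ (<-≤-trans z<z (Before⇒z≤ p j r l b))
Before-trans q k p j r l (inj₂ (z≡z , _))   (inj₁ z<z) = inj₁ (≤-<-trans (≤-reflexive z≡z) z<z)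
Before-trans q k p j r l (inj₂ (z≡z , p<q)) (inj₂ (z≡z′ , r<p)) = inj₂ (trans z≡z z≡z′ , <-trans r<p p<q)

Before-irrefl : ∀ q k → ¬ Before q k q k
Before-irrefl q k (inj₁ z<z)     = <-irrefl refl z<z
Before-irrefl q k (inj₂ (_ , q<q)) = <-irrefl refl q<q

Before-trichotomy : ∀ q .{{_ : NonZero q}} k p j → Before q k p j ⊎ Before p j q k ⊎ (q ≡ p × k ≡ j)
Before-trichotomy q k p j with <-cmp (z q k) (z p j)
... | tri< z<z _ _ = inj₁ (inj₁ z<z)
... | tri> _ _ z>z = inj₂ (inj₁ (inj₁ z>z))
... | tri≈ _ z≡z _ with <-cmp q p
...   | tri< q<p _ _ = inj₂ (inj₁ (inj₂ (sym z≡z , q<p)))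
...   | tri> _ _ p<q = inj₁ (inj₂ (z≡z , p<q))
...   | tri≈ _ refl _ = inj₂ (inj₂ (refl , z-injective z≡z))

Before-bounded : ∀ {q k} p j → ValidPair q k → Before q k p j → q ≤ z p j × k ≤ z p j
Before-bounded {q} {k} p j (pq , 1≤k) b = ≤-trans (q≤z 1≤k) z≤z , ≤-trans (k≤z k) z≤z
  where
  instance _ = prime⇒nonZero pq
  z≤z : z q k ≤ z p j
  z≤z = Before⇒z≤ q k p j b

module _ {r} {R : ℕ → ℕ → Set r} (R? : ∀ q k → Dec (R q k)) where

  countPairs : ℕ → ℕ
  countPairs B = ∑.bigₚ B (λ q → ∑.big B (λ k → indicator (R? q k)))

  countPairs-ext : ∀ {C B} → C ≤ B → (∀ {q k} → ValidPair q k → R q k → q ≤ C × k ≤ C) →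
                   countPairs B ≡ countPairs C
  countPairs-ext {C} {B} C≤B bounded =
    trans (∑.bigₚ-cong B (λ pq _ → ∑.big-ext _ C≤B (λ C<k _ → if-no (R? _ _) (outsideᵏ pq C<k))))
          (∑.bigₚ-ext _ C≤B (λ pq C<q _ → ∑.big-identity C (λ 1≤k _ → if-no (R? _ _) (outsideᵠ pq 1≤k C<q))))
    where
    outsideᵏ : ∀ {q k} → Prime q → C < k → ¬ R q k
    outsideᵏ pq C<k Rqk = <⇒≱ C<k (proj₂ (bounded (pq , ≤-trans z<s C<k) Rqk))
    outsideᵠ : ∀ {q k} → Prime q → 1 ≤ k → C < q → ¬ R q k
    outsideᵠ pq 1≤k C<q Rqk = <⇒≱ C<q (proj₁ (bounded (pq , 1≤k) Rqk))

  countPairs-zero : ∀ B → (∀ {q k} → ValidPair q k → ¬ R q k) → countPairs B ≡ 0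
  countPairs-zero B never =
    ∑.bigₚ-identity B (λ pq _ → ∑.big-identity B (λ 1≤k _ → if-no (R? _ _) (never (pq , 1≤k))))

  countPairs-≤1 : ∀ B → (∀ {q k q′ k′} → ValidPair q k → ValidPair q′ k′ → R q k → R q′ k′ → q ≡ q′ × k ≡ k′) →
                  countPairs B ≤ 1
  countPairs-≤1 B unique = ∑.bigₚ-≤1 B inner-≤1 inner-unique
    where
    inner-≤1 : ∀ {q} → Prime q → q ≤ B → ∑.big B (λ k → indicator (R? q k)) ≤ 1
    inner-≤1 pq _ = ∑.big-≤1 B (λ _ _ → indicator-≤1 (R? _ _))
      (λ 1≤k _ 1≤k′ _ Rk Rk′ → proj₂ (unique (pq , 1≤k) (pq , 1≤k′) (indicator-pos (R? _ _) Rk) (indicator-pos (R? _ _) Rk′)))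
    inner-unique : ∀ {q q′} → Prime q → q ≤ B → Prime q′ → q′ ≤ B →
                   1 ≤ ∑.big B (λ k → indicator (R? q k)) → 1 ≤ ∑.big B (λ k → indicator (R? q′ k)) → q ≡ q′
    inner-unique pq _ pq′ _ pos pos′ with ∑.big-pos B pos | ∑.big-pos B pos′
    ... | k , 1≤k , _ , Rk | k′ , 1≤k′ , _ , Rk′ =
      proj₁ (unique (pq , 1≤k) (pq′ , 1≤k′) (indicator-pos (R? _ _) Rk) (indicator-pos (R? _ _) Rk′))

module _ {r r′} {R : ℕ → ℕ → Set r} {R′ : ℕ → ℕ → Set r′}
         (R? : ∀ q k → Dec (R q k)) (R′? : ∀ q k → Dec (R′ q k)) where

  countPairs-mono : ∀ B → (∀ {q k} → ValidPair q k → R q k → R′ q k) → countPairs R? B ≤ countPairs R′? B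
  countPairs-mono B R⇒R′ = ∑.bigₚ-mono B (λ pq _ → ∑.big-mono B (λ 1≤k _ → indicator-mono (R? _ _) (R′? _ _) (R⇒R′ (pq , 1≤k))))

  countPairs-< : ∀ B → (∀ {q k} → ValidPair q k → R q k → R′ q k) →
                 ∀ {q k} → ValidPair q k → q ≤ B → k ≤ B → ¬ R q k → R′ q k → countPairs R? B < countPairs R′? B
  countPairs-< B R⇒R′ (pq , 1≤k) q≤B k≤B ¬Rqk R′qk =
    ∑.bigₚ-< B (λ pq _ → inner-mono pq) pq q≤B
      (∑.big-< B (λ 1≤k _ → indicator-mono (R? _ _) (R′? _ _) (R⇒R′ (pq , 1≤k))) 1≤k k≤B (indicator-< (R? _ _) (R′? _ _) ¬Rqk R′qk))
    where
    inner-mono : ∀ {q} → Prime q → ∑.big B (λ k → indicator (R? q k)) ≤ ∑.big B (λ k → indicator (R′? q k))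
    inner-mono pq = ∑.big-mono B (λ 1≤k _ → indicator-mono (R? _ _) (R′? _ _) (R⇒R′ (pq , 1≤k)))

module _ {r r′} {R : ℕ → ℕ → Set r} {R′ : ℕ → ℕ → Set r′}
         (R? : ∀ q k → Dec (R q k)) (R′? : ∀ q k → Dec (R′ q k)) where

  countPairs-cong : ∀ B → (∀ {q k} → ValidPair q k → R q k → R′ q k) → (∀ {q k} → ValidPair q k → R′ q k → R q k) →
                    countPairs R? B ≡ countPairs R′? B
  countPairs-cong B R⇒R′ R′⇒R = ≤-antisym (countPairs-mono R? R′? B R⇒R′) (countPairs-mono R′? R? B R′⇒R)

  countPairs-+ : ∀ {r″} {R″ : ℕ → ℕ → Set r″} (R″? : ∀ q k → Dec (R″ q k)) B →
                 (∀ {q k} → ValidPair q k → indicator (R″? q k) ≡ indicator (R? q k) + indicator (R′? q k)) →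
                 countPairs R″? B ≡ countPairs R? B + countPairs R′? B
  countPairs-+ R″? B split =
    trans (∑.bigₚ-cong B (λ pq _ → trans (∑.big-cong B (λ 1≤k _ → split (pq , 1≤k))) (∑.big-∙ B _ _)))
          (∑.bigₚ-∙ B _ _)

rank≡countPairs : ∀ p j {B} → z p j ≤ B → rank p j ≡ countPairs (λ q k → before? q k p j) B
rank≡countPairs p j {B} z≤B =
  trans rank≡countPairs-z (sym (countPairs-ext (λ q k → before? q k p j) z≤B (Before-bounded p j)))
  where
  open ≡-Reasoning
  Z : ℕ
  Z = z p j
  P? : ∀ qk → Dec (Before (proj₁ qk) (proj₂ qk) p j)
  P? (q , k) = before? q k p j
  row : ℕ → List (ℕ × ℕ)
  row q = map (q ,_) (applyUpTo suc Z)
  row-sum : ∀ q → sum (map (indicator ∘ P?) (row q)) ≡ ∑.big Z (λ k → indicator (before? q k p j))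
  row-sum q = begin
    sum (map (indicator ∘ P?) (map (q ,_) (applyUpTo suc Z))) ≡⟨ cong sum (sym (map-∘ (applyUpTo suc Z))) ⟩
    sum (map (λ k → indicator (before? q k p j)) (applyUpTo suc Z)) ≡⟨ cong sum (map-applyUpTo suc _ Z) ⟩
    sum (applyUpTo (λ k → indicator (before? q (suc k) p j)) Z) ≡⟨ ∑.foldr-applyUpTo Z _ ⟩
    ∑.big Z (λ k → indicator (before? q k p j)) ∎
  rank≡countPairs-z : rank p j ≡ countPairs (λ q k → before? q k p j) Z
  rank≡countPairs-z = begin
    length (filter P? (pairsUpTo Z))                                 ≡⟨ length-filter P? (pairsUpTo Z) ⟩
    sum (map (indicator ∘ P?) (pairsUpTo Z))                         ≡⟨ sum-map-concatMap _ row (filter prime? (upTo (suc Z))) ⟩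
    sum (map (λ q → sum (map (indicator ∘ P?) (row q))) (filter prime? (upTo (suc Z))))
                                                                     ≡⟨ ∑.foldr-map-primesTo Z _ ⟩
    ∑.bigₚ Z (λ q → sum (map (indicator ∘ P?) (row q)))               ≡⟨ ∑.bigₚ-cong Z (λ {q} _ _ → row-sum q) ⟩
    countPairs (λ q k → before? q k p j) Z                           ∎

rank-< : ∀ {q k} p j → ValidPair q k → Before q k p j → rank q k < rank p j
rank-< {q} {k} p j v b = subst₂ _<_
  (sym (rank≡countPairs q k (Before⇒z≤ q k p j b)))
  (sym (rank≡countPairs p j ≤-refl))
  (countPairs-< (λ x y → before? x y q k) (λ x y → before? x y p j) (z p j)
     (λ {x} {y} _ b′ → Before-trans x y q k p j b′ b)
     v (proj₁ (Before-bounded p j v b)) (proj₂ (Before-bounded p j v b)) (Before-irrefl q k) b)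

rank<⇒Before : ∀ {q k p j} → ValidPair q k → ValidPair p j → rank q k < rank p j → Before q k p j
rank<⇒Before {q} {k} {p} {j} v@(pq , _) w r< with Before-trichotomy q {{prime⇒nonZero pq}} k p j
... | inj₁ b               = b
... | inj₂ (inj₁ b)        = contradiction r< (<-asym (rank-< q k w b))
... | inj₂ (inj₂ (refl , refl)) = contradiction r< (<-irrefl refl)

rank-injective : ∀ {q k p j} → ValidPair q k → ValidPair p j → rank q k ≡ rank p j → q ≡ p × k ≡ j
rank-injective {q} {k} {p} {j} v@(pq , _) w r≡ with Before-trichotomy q {{prime⇒nonZero pq}} k p j
... | inj₁ b        = contradiction r≡ (<⇒≢ (rank-< p j v b))
... | inj₂ (inj₁ b) = contradiction (sym r≡) (<⇒≢ (rank-< q k w b))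
... | inj₂ (inj₂ e) = e

rank-mono : ∀ {p k j} → Prime p → 1 ≤ k → k ≤ j → rank p k ≤ rank p j
rank-mono {p} {k} {j} pp 1≤k k≤j with m≤n⇒m<n∨m≡n k≤j
... | inj₁ k<j  = <⇒≤ (rank-< p j (pp , 1≤k) (inj₁ (z-< {{prime⇒nonZero pp}} k<j)))
... | inj₂ refl = ≤-refl

k≤rank[2,1+k] : ∀ k → k ≤ rank 2 (suc k)
k≤rank[2,1+k] zero    = z≤n
k≤rank[2,1+k] (suc k) = ≤-<-trans (k≤rank[2,1+k] k) (rank-< 2 (2 + k) (prime[2] , s≤s (z≤n {k})) (inj₁ (z-<-suc {2} (suc k))))

z[2,m]+2≡bound : ∀ m → z 2 m + 2 ≡ bound m
z[2,m]+2≡bound zero    = refl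
z[2,m]+2≡bound (suc m) = begin
  z 2 (suc m) + 2          ≡⟨ cong (_+ 2) (z-suc 2 m) ⟩
  z 2 m + 2 ^ suc m + 2    ≡⟨ +-assoc (z 2 m) _ 2 ⟩
  z 2 m + (2 ^ suc m + 2)  ≡⟨ cong (z 2 m +_) (+-comm (2 ^ suc m) 2) ⟩
  z 2 m + (2 + 2 ^ suc m)  ≡⟨ sym (+-assoc (z 2 m) 2 _) ⟩
  z 2 m + 2 + 2 ^ suc m    ≡⟨ cong (_+ 2 ^ suc m) (z[2,m]+2≡bound m) ⟩
  2 ^ suc m + 2 ^ suc m    ≡⟨ cong (2 ^ suc m +_) (sym (+-identityʳ (2 ^ suc m))) ⟩
  bound (suc m)            ∎
  where open ≡-Reasoning

rank<⇒z≤z[2,m] : ∀ {p k} m → ValidPair p k → rank p k < m → z p k ≤ z 2 m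
rank<⇒z≤z[2,m] {p} {k} (suc m) v r<1+m with z 2 (suc m) <? z p k
... | yes z[2,m]<z = contradiction (≤-trans (s≤s (k≤rank[2,1+k] m)) (rank-< p k (prime[2] , s≤s (z≤n {m})) (inj₁ z[2,m]<z))) (<⇒≱ r<1+m)
... | no  z[2,m]≮z = ≮⇒≥ z[2,m]≮z

rank<⇒bounded : ∀ {p k m} → ValidPair p k → rank p k < m → p < bound m × k < bound m
rank<⇒bounded {p} {k} {m} v@(pp , 1≤k) r<m = ≤-<-trans (q≤z 1≤k) z<bound , ≤-<-trans (k≤z k) z<bound
  where
  instance _ = prime⇒nonZero pp
  z<bound : z p k < bound m
  z<bound = <-≤-trans (≤-<-trans (rank<⇒z≤z[2,m] m v r<m) (m<m+n (z 2 m) z<s)) (≤-reflexive (z[2,m]+2≡bound m))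

-- The set E_m and the exponents k_p

countRank< : ℕ → ℕ → ℕ
countRank< B m = countPairs (λ q k → rank q k <? m) B

indicator-<-suc : ∀ r m → indicator (r <? suc m) ≡ indicator (r <? m) + indicator (r ≟ m)
indicator-<-suc r m with <-cmp r m
... | tri< r<m r≢m _ rewrite dec-true (r <? suc m) (m<n⇒m<1+n r<m) | dec-true (r <? m) r<m | dec-false (r ≟ m) r≢m = refl
... | tri≈ r≮m r≡m _ rewrite dec-true (r <? suc m) (s≤s (≤-reflexive r≡m)) | dec-false (r <? m) r≮m | dec-true (r ≟ m) r≡m = refl
... | tri> r≮m r≢m m<r rewrite dec-false (r <? suc m) (<⇒≱ m<r ∘ ≤-pred) | dec-false (r <? m) r≮m | dec-false (r ≟ m) r≢m = refl

countRank<-≤ : ∀ B m → countRank< B m ≤ m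
countRank<-≤ B zero    = ≤-reflexive (countPairs-zero (λ q k → rank q k <? 0) B (λ _ ()))
countRank<-≤ B (suc m) = begin
  countRank< B (suc m)                                       ≡⟨ countPairs-+ (λ q k → rank q k <? m) (λ q k → rank q k ≟ m) (λ q k → rank q k <? suc m) B
                                                                  (λ _ → indicator-<-suc _ m) ⟩
  countRank< B m + countPairs (λ q k → rank q k ≟ m) B        ≤⟨ +-mono-≤ (countRank<-≤ B m) rank≡m-unique ⟩
  m + 1                                                      ≡⟨ +-comm m 1 ⟩
  suc m                                                      ∎
  where
  open ≤-Reasoning
  rank≡m-unique : countPairs (λ q k → rank q k ≟ m) B ≤ 1
  rank≡m-unique = countPairs-≤1 (λ q k → rank q k ≟ m) B (λ v v′ r≡m r′≡m → rank-injective v v′ (trans r≡m (sym r′≡m)))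

-- Let r be the least rank ≥ m of a pair; the search is bounded since (2, m + 1) has rank ≥ m.
-- By minimality the pairs of rank < m are exactly those before the pair of rank r, so
-- r = countRank< (…) m ≤ m.
module _ (m : ℕ) where

  private
    Z : ℕ
    Z = z 2 (suc m)

    Witness : ℕ → Set
    Witness r = m ≤ r × ∃ λ q → q < suc Z × ∃ λ k → k < suc Z × ValidPair q k × z q k ≤ Z × rank q k ≡ r

    witness? : Decidable Witness
    witness? r = m ≤? r ×-dec anyUpTo? (λ q → anyUpTo? (λ k →
                   (prime? q ×-dec 1 ≤? k) ×-dec z q k ≤? Z ×-dec rank q k ≟ r) (suc Z)) (suc Z)

    witness₀ : Witness (rank 2 (suc m))
    witness₀ = k≤rank[2,1+k] m , 2 , s≤s (q≤z {2} (s≤s (z≤n {m}))) , suc m , s≤s (k≤z {2} (suc m)) ,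
               (prime[2] , s≤s (z≤n {m})) , ≤-refl , refl

  rank-surjective : ∃₂ λ p j → ValidPair p j × rank p j ≡ m
  rank-surjective with minimal-witness witness? (suc (rank 2 (suc m))) (_ , ≤-refl , witness₀)
  ... | r , (m≤r , p , _ , j , _ , v , z≤Z , rank≡r) , minimal = p , j , v , ≤-antisym rank≤m m≤rank
    where
    m≤rank : m ≤ rank p j
    m≤rank = subst (m ≤_) (sym rank≡r) m≤r
    Before⇒rank< : ∀ {q k} → ValidPair q k → Before q k p j → rank q k < m
    Before⇒rank< {q} {k} v′@(pq , 1≤k) b with rank q k <? m
    ... | yes r<m = r<m
    ... | no  r≮m = contradiction witness (minimal (subst (rank q k <_) rank≡r (rank-< p j v′ b)))
      where
      instance _ = prime⇒nonZero pq
      z≤Z′ : z q k ≤ Z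
      z≤Z′ = ≤-trans (Before⇒z≤ q k p j b) z≤Z
      witness : Witness (rank q k)
      witness = ≮⇒≥ r≮m , q , s≤s (≤-trans (q≤z 1≤k) z≤Z′) , k , s≤s (≤-trans (k≤z k) z≤Z′) , v′ , z≤Z′ , refl
    rank≤m : rank p j ≤ m
    rank≤m = begin
      rank p j                                         ≡⟨ rank≡countPairs p j ≤-refl ⟩
      countPairs (λ q k → before? q k p j) (z p j)     ≡⟨ countPairs-cong (λ q k → before? q k p j) (λ q k → rank q k <? m) (z p j)
                                                            Before⇒rank< (λ {q} {k} v′ r<m → rank<⇒Before {q} {k} {p} {j} v′ v (<-≤-trans r<m m≤rank)) ⟩
      countRank< (z p j) m                             ≤⟨ countRank<-≤ (z p j) m ⟩
      m                                                ∎
      where open ≤-Reasoning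

countRank<≡m : ∀ {B} m → bound m ≤ B → countRank< B m ≡ m
countRank<≡m {B} m bound≤B = count (rank-surjective m)
  where
  open ≡-Reasoning
  bounded : ∀ {q k} → ValidPair q k → rank q k < m → q ≤ B × k ≤ B
  bounded {q} {k} v′ r<m with rank<⇒bounded {q} {k} {m} v′ r<m
  ... | q<bound , k<bound = ≤-trans (<⇒≤ q<bound) bound≤B , ≤-trans (<⇒≤ k<bound) bound≤B
  count : (∃₂ λ p j → ValidPair p j × rank p j ≡ m) → countRank< B m ≡ m
  count (p , j , v , rank≡m) = begin
    countRank< B m                                     ≡⟨ sym (countPairs-ext (λ q k → rank q k <? m) (m≤m⊔n B (z p j)) bounded) ⟩
    countRank< (B ⊔ z p j) m                           ≡⟨ countPairs-cong (λ q k → rank q k <? m) (λ q k → before? q k p j) (B ⊔ z p j)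
                                                            (λ {q} {k} v′ r<m → rank<⇒Before {q} {k} {p} {j} v′ v (subst (rank q k <_) (sym rank≡m) r<m))
                                                            (λ {q} {k} v′ b → subst (rank q k <_) rank≡m (rank-< p j v′ b)) ⟩
    countPairs (λ q k → before? q k p j) (B ⊔ z p j)   ≡⟨ sym (rank≡countPairs p j (m≤n⊔m B (z p j))) ⟩
    rank p j                                           ≡⟨ rank≡m ⟩
    m                                                  ∎

kp-complete : ∀ {m p k} → ValidPair p k → rank p k < m → k ≤ kp m p
kp-complete {m} {p} {suc k} v r<m =
  foldr-⊔-upperBound _ (∈-filter⁺ (λ j → rank p j <? m) (∈-applyUpTo⁺ suc (<⇒≤ (proj₂ (rank<⇒bounded {p} {suc k} {m} v r<m)))) r<m)

kp-sound : ∀ {m p k} → ValidPair p k → k ≤ kp m p → rank p k < m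
kp-sound {m} {p} {k} (pp , 1≤k) k≤kp with foldr-⊔-selective (filter (λ j → rank p j <? m) (applyUpTo suc (bound m)))
... | inj₁ kp≡0  = contradiction (≤-trans 1≤k (≤-trans k≤kp (≤-reflexive kp≡0))) λ ()
... | inj₂ kp∈ks = ≤-<-trans (rank-mono {p} {k} {kp m p} pp 1≤k k≤kp) (proj₂ (∈-filter⁻ (λ j → rank p j <? m) {xs = applyUpTo suc (bound m)} kp∈ks))

kp-bounded : ∀ {m p} → Prime p → 1 ≤ kp m p → p < bound m × kp m p < bound m
kp-bounded {m} {p} pp 1≤kp = rank<⇒bounded {p} {kp m p} {m} (pp , 1≤kp) (kp-sound {m} {p} {kp m p} (pp , 1≤kp) ≤-refl)

kp≤bound : ∀ {m p} → Prime p → kp m p ≤ bound m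
kp≤bound {m} {p} pp with 1 ≤? kp m p
... | yes 1≤kp = <⇒≤ (proj₂ (kp-bounded {m} {p} pp 1≤kp))
... | no  1≰kp = ≤-trans (≤-pred (≰⇒> 1≰kp)) z≤n

kp-vanishes : ∀ {m p} → Prime p → bound m ≤ p → kp m p ≡ 0
kp-vanishes {m} {p} pp bound≤p with 1 ≤? kp m p
... | yes 1≤kp = contradiction bound≤p (<⇒≱ (proj₁ (kp-bounded {m} {p} pp 1≤kp)))
... | no  1≰kp = n<1⇒n≡0 (≰⇒> 1≰kp)

∑-indicator-≤ : ∀ {K B} → K ≤ B → ∑.big B (λ k → indicator (k ≤? K)) ≡ K
∑-indicator-≤ {K} {B} K≤B = begin
  ∑.big B (λ k → indicator (k ≤? K)) ≡⟨ ∑.big-ext _ K≤B (λ K<k _ → if-no (_ ≤? K) (<⇒≱ K<k)) ⟩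
  ∑.big K (λ k → indicator (k ≤? K)) ≡⟨ ∑.big-cong K (λ _ k≤K → if-yes (_ ≤? K) k≤K) ⟩
  ∑.big K (λ _ → 1)                  ≡⟨ ∑-1 K ⟩
  K                                  ∎
  where
  open ≡-Reasoning
  ∑-1 : ∀ n → ∑.big n (λ _ → 1) ≡ n
  ∑-1 zero    = refl
  ∑-1 (suc n) = trans (cong (_+ 1) (∑-1 n)) (+-comm n 1)

∑ₚkp≡m : ∀ {B} m → bound m ≤ B → ∑.bigₚ B (kp m) ≡ m
∑ₚkp≡m {B} m bound≤B = trans (∑.bigₚ-cong B (λ pq _ → sym (row pq))) (countRank<≡m m bound≤B)
  where
  row : ∀ {q} → Prime q → ∑.big B (λ k → indicator (rank q k <? m)) ≡ kp m q
  row {q} pq = trans (∑.big-cong B (λ {k} 1≤k _ → indicator-cong (rank q k <? m) (k ≤? kp m q)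
                                                 (kp-complete {m} {q} {k} (pq , 1≤k)) (kp-sound {m} {q} {k} (pq , 1≤k))))
                     (∑-indicator-≤ (≤-trans (kp≤bound {m} {q} pq) bound≤B))

nmFactors : ℕ → List ℕ
nmFactors m = concatMap (λ p → replicate (kp m p) p) (filter prime? (upTo (suc (bound m))))

nmFactors-prime : ∀ m → All Prime (nmFactors m)
nmFactors-prime m = All.concat⁺ (All.map⁺ (All.map (All.replicate⁺ _) (All.all-filter prime? (upTo (suc (bound m))))))

product-nmFactors : ∀ m → product (nmFactors m) ≡ nm m
product-nmFactors m = product-concatMap-replicate (kp m) (filter prime? (upTo (suc (bound m))))

length-nmFactors : ∀ m → length (nmFactors m) ≡ m
length-nmFactors m = begin
  length (nmFactors m)                                          ≡⟨ length-concatMap-replicate (kp m) (filter prime? (upTo (suc (bound m)))) ⟩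
  sum (map (kp m) (filter prime? (upTo (suc (bound m)))))       ≡⟨ ∑.foldr-map-primesTo (bound m) (kp m) ⟩
  ∑.bigₚ (bound m) (kp m)                                       ≡⟨ ∑ₚkp≡m m ≤-refl ⟩
  m                                                             ∎
  where open ≡-Reasoning

nm≡∏ₚ : ∀ {B} m → bound m ≤ B → nm m ≡ ∏.bigₚ B (λ q → q ^ kp m q)
nm≡∏ₚ {B} m bound≤B =
  trans (∏.foldr-map-primesTo (bound m) (λ q → q ^ kp m q))
        (sym (∏.bigₚ-ext _ bound≤B (λ {q} pq bound<q _ → cong (q ^_) (kp-vanishes {m} {q} pq (<⇒≤ bound<q)))))

kp-threshold : ∀ m → ∃ λ t → 1 ≤ t × (∀ {q k} → Prime q → 1 ≤ k → k ≤ kp m q → z q k ≤ t)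
                                  × (∀ {q k} → Prime q → kp m q < k → t ≤ z q k)
kp-threshold m = threshold (rank-surjective m)
  where
  threshold : (∃₂ λ p j → ValidPair p j × rank p j ≡ m) →
              ∃ λ t → 1 ≤ t × (∀ {q k} → Prime q → 1 ≤ k → k ≤ kp m q → z q k ≤ t)
                            × (∀ {q k} → Prime q → kp m q < k → t ≤ z q k)
  threshold (p , j , v@(pp , 1≤j) , rank≡m) = z p j , ≤-trans (>-nonZero⁻¹ p) (q≤z 1≤j) , below , above
    where
    instance _ = prime⇒nonZero pp
    below : ∀ {q k} → Prime q → 1 ≤ k → k ≤ kp m q → z q k ≤ z p j
    below {q} {k} pq 1≤k k≤kp = Before⇒z≤ q k p j (rank<⇒Before {q} {k} {p} {j} (pq , 1≤k) v
                                   (subst (rank q k <_) (sym rank≡m) (kp-sound {m} {q} {k} (pq , 1≤k) k≤kp)))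
    above : ∀ {q k} → Prime q → kp m q < k → z p j ≤ z q k
    above {q} {k} pq kp<k with Before-trichotomy q {{prime⇒nonZero pq}} k p j
    ... | inj₁ b = contradiction (kp-complete {m} {q} {k} (pq , 1≤k) (subst (rank q k <_) rank≡m (rank-< p j (pq , 1≤k) b)))
                                 (<⇒≱ kp<k)
      where 1≤k = ≤-trans (s≤s z≤n) kp<k
    ... | inj₂ (inj₁ b)             = Before⇒z≤ p j q k b
    ... | inj₂ (inj₂ (refl , refl)) = ≤-refl

-- Exchanging exponents

module _ (q t : ℕ) where

  -- W a is σ (q ^ a).
  private
    W : ℕ → ℕ
    W a = suc (z q a)

    Q : ℕ
    Q = q * suc t

    σ-step-up : ∀ {i} → z q (suc i) ≤ t → W i * Q ≤ W (suc i) * t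
    σ-step-up {i} z≤t = subst (_≤ W (suc i) * t) (sym (z-suc-Horner-* q i (suc t))) (*-suc-≤ z≤t)

    σ-step-down : ∀ {i} → t ≤ z q (suc i) → W (suc i) * t ≤ W i * Q
    σ-step-down {i} t≤z = subst (W (suc i) * t ≤_) (sym (z-suc-Horner-* q i (suc t))) (*-suc-≥ t≤z)

  σ-ratio-up : ∀ a d → (∀ {i} → a ≤ i → i < a + d → z q (suc i) ≤ t) →
               W a * t ^ a * Q ^ (a + d) ≤ W (a + d) * t ^ (a + d) * Q ^ a
  σ-ratio-up a d below = begin
    W a * t ^ a * Q ^ (a + d)              ≡⟨ cong (W a * t ^ a *_) (^-distribˡ-+-* Q a d) ⟩
    W a * t ^ a * (Q ^ a * Q ^ d)          ≡⟨ solve 4 (λ w x y u → w :* x :* (y :* u) := w :* u :* (x :* y)) refl (W a) (t ^ a) (Q ^ a) (Q ^ d) ⟩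
    W a * Q ^ d * (t ^ a * Q ^ a)          ≤⟨ *-monoˡ-≤ (t ^ a * Q ^ a) (geometric-growth W Q t a d (λ {i} a≤i i<a+d → σ-step-up {i} (below a≤i i<a+d))) ⟩
    W (a + d) * t ^ d * (t ^ a * Q ^ a)    ≡⟨ solve 4 (λ w x y u → w :* u :* (x :* y) := w :* (x :* u) :* y) refl (W (a + d)) (t ^ a) (Q ^ a) (t ^ d) ⟩
    W (a + d) * (t ^ a * t ^ d) * Q ^ a    ≡⟨ cong (λ x → W (a + d) * x * Q ^ a) (sym (^-distribˡ-+-* t a d)) ⟩
    W (a + d) * t ^ (a + d) * Q ^ a        ∎
    where open ≤-Reasoning

  σ-ratio-down : ∀ K d → (∀ {i} → K ≤ i → i < K + d → t ≤ z q (suc i)) →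
                 W (K + d) * t ^ (K + d) * Q ^ K ≤ W K * t ^ K * Q ^ (K + d)
  σ-ratio-down K d above = begin
    W (K + d) * t ^ (K + d) * Q ^ K        ≡⟨ cong (λ x → W (K + d) * x * Q ^ K) (^-distribˡ-+-* t K d) ⟩
    W (K + d) * (t ^ K * t ^ d) * Q ^ K    ≡⟨ solve 4 (λ w x y u → w :* (x :* u) :* y := w :* u :* (x :* y)) refl (W (K + d)) (t ^ K) (Q ^ K) (t ^ d) ⟩
    W (K + d) * t ^ d * (t ^ K * Q ^ K)    ≤⟨ *-monoˡ-≤ (t ^ K * Q ^ K) (geometric-decay W Q t K d (λ {i} K≤i i<K+d → σ-step-down {i} (above K≤i i<K+d))) ⟩
    W K * Q ^ d * (t ^ K * Q ^ K)          ≡⟨ solve 4 (λ w x y u → w :* u :* (x :* y) := w :* x :* (y :* u)) refl (W K) (t ^ K) (Q ^ K) (Q ^ d) ⟩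
    W K * t ^ K * (Q ^ K * Q ^ d)          ≡⟨ cong (W K * t ^ K *_) (sym (^-distribˡ-+-* Q K d)) ⟩
    W K * t ^ K * Q ^ (K + d)              ∎
    where open ≤-Reasoning

  σ-ratio : ∀ a K → (∀ {k} → 1 ≤ k → k ≤ K → z q k ≤ t) → (∀ {k} → K < k → t ≤ z q k) →
            W a * t ^ a * Q ^ K ≤ W K * t ^ K * Q ^ a
  σ-ratio a K below above with ≤-total a K
  ... | inj₁ a≤K with m≤n⇒∃[o]m+o≡n a≤K
  ...   | d , refl = σ-ratio-up a d (λ _ i<a+d → below z<s i<a+d)
  σ-ratio a K below above | inj₂ K≤a with m≤n⇒∃[o]m+o≡n K≤a
  ...   | d , refl = σ-ratio-down K d (λ K≤i _ → above (s≤s K≤i))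

∏ₚ-σ-split : ∀ B (e f : ℕ → ℕ) t s →
  ∏.bigₚ B (λ q → suc (z q (e q)) * t ^ e q * (q * s) ^ f q)
    ≡ σ (∏.bigₚ B (λ q → q ^ e q)) * t ^ ∑.bigₚ B e * (∏.bigₚ B (λ q → q ^ f q) * s ^ ∑.bigₚ B f)
∏ₚ-σ-split B e f t s = begin
  ∏.bigₚ B (λ q → suc (z q (e q)) * t ^ e q * (q * s) ^ f q)
    ≡⟨ ∏.bigₚ-∙ B _ _ ⟩
  ∏.bigₚ B (λ q → suc (z q (e q)) * t ^ e q) * ∏.bigₚ B (λ q → (q * s) ^ f q)
    ≡⟨ cong₂ _*_ (∏.bigₚ-∙ B _ _) (trans (∏.bigₚ-cong B (λ {q} _ _ → ^-distribʳ-* q s (f q))) (∏.bigₚ-∙ B _ _)) ⟩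
  ∏.bigₚ B (λ q → suc (z q (e q))) * ∏.bigₚ B (λ q → t ^ e q) * (∏.bigₚ B (λ q → q ^ f q) * ∏.bigₚ B (λ q → s ^ f q))
    ≡⟨ cong₂ (λ x y → x * y * (∏.bigₚ B (λ q → q ^ f q) * ∏.bigₚ B (λ q → s ^ f q))) (sym (σ-∏ₚ B e)) (∏.bigₚ-^ B t e) ⟩
  σ (∏.bigₚ B (λ q → q ^ e q)) * t ^ ∑.bigₚ B e * (∏.bigₚ B (λ q → q ^ f q) * ∏.bigₚ B (λ q → s ^ f q))
    ≡⟨ cong (λ x → σ (∏.bigₚ B (λ q → q ^ e q)) * t ^ ∑.bigₚ B e * (∏.bigₚ B (λ q → q ^ f q) * x)) (∏.bigₚ-^ B s f) ⟩
  σ (∏.bigₚ B (λ q → q ^ e q)) * t ^ ∑.bigₚ B e * (∏.bigₚ B (λ q → q ^ f q) * s ^ ∑.bigₚ B f)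
    ∎
  where open ≡-Reasoning

σ*nm≤σ[nm]* : ∀ m {ps} → All Prime ps → length ps ≡ m → σ (product ps) * nm m ≤ σ (nm m) * product ps
σ*nm≤σ[nm]* m {ps} pps len = fromThreshold (kp-threshold m)
  where
  open ≡-Reasoning
  B : ℕ
  B = product ps ⊔ bound m
  a : ℕ → ℕ
  a q = multiplicity q ps
  bound≤B : bound m ≤ B
  bound≤B = m≤n⊔m (product ps) (bound m)
  ps≤B : All (_≤ B) ps
  ps≤B = All.map (λ p≤ → ≤-trans p≤ (m≤m⊔n (product ps) (bound m))) (All-≤-product pps)
  ∑a≡m : ∑.bigₚ B a ≡ m
  ∑a≡m = trans (sym (length≡∑ₚ pps ps≤B)) len
  ∑kp≡m : ∑.bigₚ B (kp m) ≡ m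
  ∑kp≡m = ∑ₚkp≡m m bound≤B
  fromThreshold : (∃ λ t → 1 ≤ t × (∀ {q k} → Prime q → 1 ≤ k → k ≤ kp m q → z q k ≤ t)
                             × (∀ {q k} → Prime q → kp m q < k → t ≤ z q k)) →
            σ (product ps) * nm m ≤ σ (nm m) * product ps
  fromThreshold (t , 1≤t , below , above) =
    *-cancel-≤ (σ (product ps)) (nm m) (σ (nm m)) (product ps) {t ^ m} {suc t ^ m}
      {{m^n≢0 t m {{>-nonZero 1≤t}}}} {{m^n≢0 (suc t) m}}
      (subst₂ _≤_ (expand a (kp m) (product≡∏ₚ pps ps≤B) (nm≡∏ₚ m bound≤B) ∑a≡m ∑kp≡m)
                  (expand (kp m) a (nm≡∏ₚ m bound≤B) (product≡∏ₚ pps ps≤B) ∑kp≡m ∑a≡m)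
                  (∏.bigₚ-mono B (λ {q} pq _ → σ-ratio q t (a q) (kp m q) (below pq) (above pq))))
    where
    expand : ∀ e f {x y} → x ≡ ∏.bigₚ B (λ q → q ^ e q) → y ≡ ∏.bigₚ B (λ q → q ^ f q) →
             ∑.bigₚ B e ≡ m → ∑.bigₚ B f ≡ m →
             ∏.bigₚ B (λ q → suc (z q (e q)) * t ^ e q * (q * suc t) ^ f q) ≡ σ x * t ^ m * (y * suc t ^ m)
    expand e f {x} {y} x≡ y≡ ∑e≡m ∑f≡m = begin
      ∏.bigₚ B (λ q → suc (z q (e q)) * t ^ e q * (q * suc t) ^ f q)
        ≡⟨ ∏ₚ-σ-split B e f t (suc t) ⟩
      σ (∏.bigₚ B (λ q → q ^ e q)) * t ^ ∑.bigₚ B e * (∏.bigₚ B (λ q → q ^ f q) * suc t ^ ∑.bigₚ B f)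
        ≡⟨ cong₂ (λ x i → σ x * t ^ i * (∏.bigₚ B (λ q → q ^ f q) * suc t ^ ∑.bigₚ B f)) (sym x≡) ∑e≡m ⟩
      σ x * t ^ m * (∏.bigₚ B (λ q → q ^ f q) * suc t ^ ∑.bigₚ B f)
        ≡⟨ cong₂ (λ y i → σ x * t ^ m * (y * suc t ^ i)) (sym y≡) ∑f≡m ⟩
      σ x * t ^ m * (y * suc t ^ m)
        ∎

-- ρ (1 + a) unfolds to fromℚᵘ (mkℚᵘ (+ σ (1 + a)) a), where ≤ is cross-multiplication.
ρ-mono : ∀ {a b} .{{_ : NonZero a}} .{{_ : NonZero b}} → σ a * b ≤ σ b * a → Data.Rational._≤_ (ρ a) (ρ b)
ρ-mono {suc a} {suc b} le = ℚ.toℚᵘ-cancel-≤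
  (ℚᵘ.≤-respˡ-≃ (ℚᵘ.≃-sym (ℚ.toℚᵘ-fromℚᵘ (ℚᵘ.mkℚᵘ (ℤ.+ σ (suc a)) a)))
  (ℚᵘ.≤-respʳ-≃ (ℚᵘ.≃-sym (ℚ.toℚᵘ-fromℚᵘ (ℚᵘ.mkℚᵘ (ℤ.+ σ (suc b)) b)))
  (ℚᵘ.*≤* (subst₂ ℤ._≤_ (ℤ.pos-* (σ (suc a)) (suc b)) (ℤ.pos-* (σ (suc b)) (suc a)) (ℤ.+≤+ le)))))

theorem1 : (m : ℕ) → 1 ≤ m →
    InS m (nm m) × ((n : ℕ) → InS m n → Data.Rational._≤_ (ρ n) (ρ (nm m)))
theorem1 m 1≤m = (2≤nm , nmFactors m , nmFactors-prime m , product-nmFactors m , length-nmFactors m) , ρ≤ρ[nm]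
  where
  2≤nm : 2 ≤ nm m
  2≤nm = subst (2 ≤_) (product-nmFactors m)
           (2≤product (nmFactors-prime m) (subst (1 ≤_) (sym (length-nmFactors m)) 1≤m))
  ρ≤ρ[nm] : (n : ℕ) → InS m n → Data.Rational._≤_ (ρ n) (ρ (nm m))
  ρ≤ρ[nm] n (2≤n , ps , pps , refl , len) =
    ρ-mono {{>-nonZero (<-trans z<s 2≤n)}} {{>-nonZero (<-trans z<s 2≤nm)}} (σ*nm≤σ[nm]* m pps len)
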